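{- Let $\mathfrak A$ be a structure. Every positive Horn formula is preserved by all surjective periomorphisms of $\mathfrak A$.
   Context: Structures are in a countable first-order language (relation, constant, function symbols allowed; equality and $\bot$ included). A positive Horn formula is built from atomic formulas using only $\wedge,\exists,\forall$. A function $\vec a:\mathbb N\to A$ is periodic if for some $k\ge1$, $\vec a(i)=\vec a(i\bmod k)$ for all $i$; the periodic power $\mathfrak A^{\mathrm{per}}$ is the substructure of $\mathfrak A^{\mathbb N}$ on the periodic functions; a periomorphism is a homomorphism $\mathfrak A^{\mathrm{per}}\to\mathfrak A$ (surjective if onto). A periomorphism $h$ preserves a formula $\varphi(x_0,\dots,x_{\ell-1})$ if whenever $\vec a_0,\dots,\vec a_{\ell-1}\in A^{\mathrm{per}}$ satisfy $\mathfrak A\models\varphi(\vec a_0(i),\dots,\vec a_{\ell-1}(i))$ for all $i\in\mathbb N$, then $\mathfrak A\models\varphi(h(\vec a_0),\dots,h(\vec a_{\ell-1}))$. -}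

module Defs where

open import Data.Nat using (ℕ; zero; suc; _*_; NonZero)
open import Data.Nat.DivMod using (_%_; m∣n⇒o%n%m≡o%m)
open import Data.Nat.Divisibility using (_∣_; ∣-refl; ∣-trans; n∣m*n; m∣m*n)
open import Data.Nat.Properties using (m*n≢0)
open import Data.Fin using (Fin; zero; suc)
open import Data.Vec using (Vec; []; _∷_; map)
open import Data.Product using (Σ; _×_; _,_; proj₁; proj₂; ∃)
open import Data.Empty using (⊥)
open import Relation.Binary.PropositionalEquality using (_≡_; refl; sym; trans; cong; cong₂)

-- Countable first-order signatures.
-- Constants are function symbols of arity 0.  Countability: injective
-- encodings of the symbol sets into ℕ.

record Signature : Set₁ where
  field
    RelSym   : Set
    FunSym   : Set
    relArity : RelSym → ℕ
    funArity : FunSym → ℕ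
    relCode     : RelSym → ℕ
    relCode-inj : ∀ R S → relCode R ≡ relCode S → R ≡ S
    funCode     : FunSym → ℕ
    funCode-inj : ∀ f g → funCode f ≡ funCode g → f ≡ g

open Signature public

shift : ∀ {X : Set} (a : ℕ → X) k Q .{{_ : NonZero k}} .{{_ : NonZero Q}} →
        k ∣ Q → (∀ i → a i ≡ a (i % k)) → ∀ i → a i ≡ a (i % Q)
shift a k Q k∣Q pa i =
  trans (pa i) (trans (cong a (sym (m∣n⇒o%n%m≡o%m k Q i k∣Q))) (sym (pa (i % Q))))

-- Structures (equality is interpreted as propositional equality).

record Structure (σ : Signature) : Set₁ where
  field
    Carrier : Set
    relI    : (R : RelSym σ) → Vec Carrier (relArity σ R) → Set
    funI    : (f : FunSym σ) → Vec Carrier (funArity σ f) → Carrier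

open Structure public

-- Terms and positive Horn formulas with free variables among Fin n
-- (de Bruijn style; ∃ and ∀ bind variable zero).

module _ (σ : Signature) where

  data Term (n : ℕ) : Set where
    var : Fin n → Term n
    app : (f : FunSym σ) → Vec (Term n) (funArity σ f) → Term n

  data Atom (n : ℕ) : Set where
    rel  : (R : RelSym σ) → Vec (Term n) (relArity σ R) → Atom n
    eq   : Term n → Term n → Atom n
    bot  : Atom n

  data PosHorn : ℕ → Set where
    atom : ∀ {n} → Atom n → PosHorn n
    _∧_  : ∀ {n} → PosHorn n → PosHorn n → PosHorn n
    ex   : ∀ {n} → PosHorn (suc n) → PosHorn n
    all  : ∀ {n} → PosHorn (suc n) → PosHorn n

module _ {σ : Signature} (𝔄 : Structure σ) where

  private A = Carrier 𝔄

  extend : ∀ {n} → A → (Fin n → A) → Fin (suc n) → A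
  extend a ρ zero    = a
  extend a ρ (suc j) = ρ j

  mutual
    evalT : ∀ {n} → (Fin n → A) → Term σ n → A
    evalT ρ (var x)    = ρ x
    evalT ρ (app f ts) = funI 𝔄 f (evalTs ρ ts)

    evalTs : ∀ {n k} → (Fin n → A) → Vec (Term σ n) k → Vec A k
    evalTs ρ []       = []
    evalTs ρ (t ∷ ts) = evalT ρ t ∷ evalTs ρ ts

  satAtom : ∀ {n} → (Fin n → A) → Atom σ n → Set
  satAtom ρ (rel R ts) = relI 𝔄 R (evalTs ρ ts)
  satAtom ρ (eq s t)   = evalT ρ s ≡ evalT ρ t
  satAtom ρ bot        = ⊥

  Sat : ∀ {n} → (Fin n → A) → PosHorn σ n → Set
  Sat ρ (atom a)  = satAtom ρ a
  Sat ρ (φ ∧ ψ)   = Sat ρ φ × Sat ρ ψ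
  Sat ρ (ex φ)    = Σ A λ a → Sat (extend a ρ) φ
  Sat ρ (all φ)   = (a : A) → Sat (extend a ρ) φ

  IsPeriodic : (ℕ → A) → Set
  IsPeriodic a = Σ ℕ λ k → Σ (NonZero k) λ nz → ∀ i → a i ≡ a (_%_ i k {{nz}})

  Per : Set
  Per = Σ (ℕ → A) IsPeriodic

  coord : ∀ {k} → ℕ → Vec Per k → Vec A k
  coord i as = map (λ a → proj₁ a i) as

  private
    commonPeriod : ∀ {m} (bs : Vec Per m) →
                   Σ ℕ λ P → Σ (NonZero P) λ nz →
                     ∀ i → coord i bs ≡ coord (_%_ i P {{nz}}) bs
    commonPeriod [] = 1 , _ , λ i → refl
    commonPeriod ((a , p , nzp , pa) ∷ bs) with commonPeriod bs
    ... | (Q , nzq , qbs) =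
      p * Q , m*n≢0 p Q {{nzp}} {{nzq}} , λ i →
        cong₂ _∷_ (shift a p (p * Q) {{nzp}} {{m*n≢0 p Q {{nzp}} {{nzq}}}} (m∣m*n Q) pa i)
                  (shift (λ j → coord j bs) Q (p * Q) {{nzq}} {{m*n≢0 p Q {{nzp}} {{nzq}}}} (n∣m*n p) qbs i)

  funPer : (f : FunSym σ) → Vec Per (funArity σ f) → Per
  funPer f as with commonPeriod as
  ... | (P , nz , per) =
    (λ i → funI 𝔄 f (coord i as)) , P , nz , λ i → cong (funI 𝔄 f) (per i)

  relPer : (R : RelSym σ) → Vec Per (relArity σ R) → Set
  relPer R as = ∀ i → relI 𝔄 R (coord i as)

  -- Since elements of 𝔄^per
  -- are functions ℕ → A (the periodicity witness is not part of the
  -- element), h must send pointwise-equal sequences to equal values.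

  record Periomorphism : Set where
    field
      hom     : Per → A
      ext     : ∀ a b → (∀ i → proj₁ a i ≡ proj₁ b i) → hom a ≡ hom b
      presFun : ∀ f (as : Vec Per (funArity σ f)) →
                hom (funPer f as) ≡ funI 𝔄 f (map hom as)
      presRel : ∀ R (as : Vec Per (relArity σ R)) →
                relPer R as → relI 𝔄 R (map hom as)

  open Periomorphism public

  Surjective : Periomorphism → Set
  Surjective h = ∀ (b : A) → Σ Per λ a → hom h a ≡ b

  Preserves : Periomorphism → ∀ {ℓ} → PosHorn σ ℓ → Set
  Preserves h {ℓ} φ = (as : Fin ℓ → Per) →
    (∀ i → Sat (λ j → proj₁ (as j) i) φ) →
    Sat (λ j → hom h (as j)) φ

-- A surjective periomorphism h commutes with the evaluation of terms in the
-- periodic power, so atomic formulas are preserved because h is a homomorphism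
-- (equalities because h respects pointwise equality); ⊥ holds in no coordinate.
-- For ∃, the parameters share a common period P; choosing a witness at each
-- coordinate below P and repeating it periodically gives a periodic witness
-- whose image under h witnesses the formula.  For ∀, surjectivity writes any
-- a ∈ A as h(c) with c periodic, and the hypothesis instantiated at c(i) in
-- every coordinate i yields the claim at a.
module Submission where

open import Defs
open import Data.Nat using (ℕ; suc; _*_; NonZero)
open import Data.Nat.DivMod using (_%_; m%n%n≡m%n)
open import Data.Nat.Divisibility using (n∣m*n; m∣m*n)
open import Data.Nat.Properties using (m*n≢0)
open import Data.Fin using (Fin; zero; suc)
open import Data.Vec using (Vec; []; _∷_; map)
open import Data.Vec.Functional using () renaming (_∷_ to _∷ᶠ_)
open import Data.Product using (_,_; proj₁; proj₂)
open import Function using (_∘_)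
open import Relation.Binary.PropositionalEquality
  using (_≡_; _≗_; refl; sym; trans; cong; cong₂; subst; module ≡-Reasoning)

module _ {σ : Signature} (𝔄 : Structure σ) where

  private
    A = Carrier 𝔄

  mutual
    evalT-cong : ∀ {n} {ρ ρ′ : Fin n → A} → ρ ≗ ρ′ → ∀ t → evalT 𝔄 ρ t ≡ evalT 𝔄 ρ′ t
    evalT-cong ρ≗ρ′ (var x)    = ρ≗ρ′ x
    evalT-cong ρ≗ρ′ (app f ts) = cong (funI 𝔄 f) (evalTs-cong ρ≗ρ′ ts)

    evalTs-cong : ∀ {n k} {ρ ρ′ : Fin n → A} → ρ ≗ ρ′ →
                  (ts : Vec (Term σ n) k) → evalTs 𝔄 ρ ts ≡ evalTs 𝔄 ρ′ ts
    evalTs-cong ρ≗ρ′ []       = refl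
    evalTs-cong ρ≗ρ′ (t ∷ ts) = cong₂ _∷_ (evalT-cong ρ≗ρ′ t) (evalTs-cong ρ≗ρ′ ts)

  extend-cong : ∀ {n} (a : A) {ρ ρ′ : Fin n → A} → ρ ≗ ρ′ → extend 𝔄 a ρ ≗ extend 𝔄 a ρ′
  extend-cong a ρ≗ρ′ zero    = refl
  extend-cong a ρ≗ρ′ (suc j) = ρ≗ρ′ j

  Sat-cong : ∀ {n} {ρ ρ′ : Fin n → A} → ρ ≗ ρ′ → ∀ φ → Sat 𝔄 ρ φ → Sat 𝔄 ρ′ φ
  Sat-cong ρ≗ρ′ (atom (rel R ts)) r       = subst (relI 𝔄 R) (evalTs-cong ρ≗ρ′ ts) r
  Sat-cong ρ≗ρ′ (atom (eq s t))   s≡t     =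
    trans (sym (evalT-cong ρ≗ρ′ s)) (trans s≡t (evalT-cong ρ≗ρ′ t))
  Sat-cong ρ≗ρ′ (φ ∧ ψ)           (p , q) = Sat-cong ρ≗ρ′ φ p , Sat-cong ρ≗ρ′ ψ q
  Sat-cong ρ≗ρ′ (ex φ)            (a , p) = a , Sat-cong (extend-cong a ρ≗ρ′) φ p
  Sat-cong ρ≗ρ′ (all φ)           p a     = Sat-cong (extend-cong a ρ≗ρ′) φ (p a)

  ∷-extend : ∀ {X : Set} {n} (f : X → A) (x : X) (ρ : Fin n → X) →
             f ∘ (x ∷ᶠ ρ) ≗ extend 𝔄 (f x) (f ∘ ρ)
  ∷-extend f x ρ zero    = refl
  ∷-extend f x ρ (suc j) = refl

  slice : ∀ {n} → (Fin n → Per 𝔄) → ℕ → Fin n → A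
  slice as i j = proj₁ (as j) i

  record CommonPeriod {n} (as : Fin n → Per 𝔄) : Set where
    field
      period         : ℕ
      {{nonZero}}    : NonZero period
      slice-periodic : ∀ i → slice as i ≗ slice as (i % period)

  commonPeriod : ∀ {n} (as : Fin n → Per 𝔄) → CommonPeriod as
  commonPeriod {0}     as = record { period = 1 ; slice-periodic = λ i () }
  commonPeriod {suc n} as = cons (proj₂ (as zero)) (commonPeriod (as ∘ suc))
    where
      cons : IsPeriodic 𝔄 (proj₁ (as zero)) → CommonPeriod (as ∘ suc) → CommonPeriod as
      cons (p , p≢0 , head-periodic) record { period = Q ; nonZero = Q≢0 ; slice-periodic = tail-periodic } =
        record { period = p * Q ; slice-periodic = periodic }
        where
          instance
            _ = p≢0
            _ = Q≢0
            pQ≢0 : NonZero (p * Q)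
            pQ≢0 = m*n≢0 p Q
          periodic : ∀ i → slice as i ≗ slice as (i % (p * Q))
          periodic i zero    = shift _ p (p * Q) (m∣m*n Q) head-periodic i
          periodic i (suc j) = shift _ Q (p * Q) (n∣m*n p) (λ k → tail-periodic k j) i

  periodise : (P : ℕ) {{_ : NonZero P}} → (ℕ → A) → Per 𝔄
  periodise P {{P≢0}} w = (λ i → w (i % P)) , P , P≢0 , λ i → cong w (sym (m%n%n≡m%n i P))

  mutual
    termPer : ∀ {n} → (Fin n → Per 𝔄) → Term σ n → Per 𝔄
    termPer as (var x)    = as x
    termPer as (app f ts) = funPer 𝔄 f (termsPer as ts)

    termsPer : ∀ {n k} → (Fin n → Per 𝔄) → Vec (Term σ n) k → Vec (Per 𝔄) k
    termsPer as []       = []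
    termsPer as (t ∷ ts) = termPer as t ∷ termsPer as ts

  mutual
    termPer-slice : ∀ {n} (as : Fin n → Per 𝔄) i t →
                    proj₁ (termPer as t) i ≡ evalT 𝔄 (slice as i) t
    termPer-slice as i (var x)    = refl
    termPer-slice as i (app f ts) = cong (funI 𝔄 f) (termsPer-slice as i ts)

    termsPer-slice : ∀ {n k} (as : Fin n → Per 𝔄) i (ts : Vec (Term σ n) k) →
                     coord 𝔄 i (termsPer as ts) ≡ evalTs 𝔄 (slice as i) ts
    termsPer-slice as i []       = refl
    termsPer-slice as i (t ∷ ts) = cong₂ _∷_ (termPer-slice as i t) (termsPer-slice as i ts)

  module _ (h : Periomorphism 𝔄) where

    mutual
      hom-termPer : ∀ {n} (as : Fin n → Per 𝔄) t →
                    hom h (termPer as t) ≡ evalT 𝔄 (hom h ∘ as) t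
      hom-termPer as (var x)    = refl
      hom-termPer as (app f ts) =
        trans (presFun h f (termsPer as ts)) (cong (funI 𝔄 f) (hom-termsPer as ts))

      hom-termsPer : ∀ {n k} (as : Fin n → Per 𝔄) (ts : Vec (Term σ n) k) →
                     map (hom h) (termsPer as ts) ≡ evalTs 𝔄 (hom h ∘ as) ts
      hom-termsPer as []       = refl
      hom-termsPer as (t ∷ ts) = cong₂ _∷_ (hom-termPer as t) (hom-termsPer as ts)

    preserves-rel : ∀ {n} R (ts : Vec (Term σ n) (relArity σ R)) → Preserves 𝔄 h (atom (rel R ts))
    preserves-rel R ts as R-slices =
      subst (relI 𝔄 R) (hom-termsPer as ts)
        (presRel h R (termsPer as ts)
          (λ i → subst (relI 𝔄 R) (sym (termsPer-slice as i ts)) (R-slices i)))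

    preserves-eq : ∀ {n} (s t : Term σ n) → Preserves 𝔄 h (atom (eq s t))
    preserves-eq s t as s≡t-slices = begin
      evalT 𝔄 (hom h ∘ as) s  ≡⟨ sym (hom-termPer as s) ⟩
      hom h (termPer as s)    ≡⟨ ext h (termPer as s) (termPer as t) termPer-s≗t ⟩
      hom h (termPer as t)    ≡⟨ hom-termPer as t ⟩
      evalT 𝔄 (hom h ∘ as) t  ∎
      where
        open ≡-Reasoning
        termPer-s≗t : proj₁ (termPer as s) ≗ proj₁ (termPer as t)
        termPer-s≗t i = begin
          proj₁ (termPer as s) i   ≡⟨ termPer-slice as i s ⟩
          evalT 𝔄 (slice as i) s   ≡⟨ s≡t-slices i ⟩
          evalT 𝔄 (slice as i) t   ≡⟨ termPer-slice as i t ⟨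
          proj₁ (termPer as t) i   ∎

    preserves-ex : ∀ {n} (φ : PosHorn σ (suc n)) → Preserves 𝔄 h φ → Preserves 𝔄 h (ex φ)
    preserves-ex φ preserves-φ as ∃-slices =
      hom h c , Sat-cong (∷-extend (hom h) c as) φ (preserves-φ (c ∷ᶠ as) φ-slices)
      where
        open CommonPeriod (commonPeriod as)
        instance
          _ = nonZero
        c : Per 𝔄
        c = periodise period (proj₁ ∘ ∃-slices)
        φ-slices : ∀ i → Sat 𝔄 (slice (c ∷ᶠ as) i) φ
        φ-slices i = Sat-cong (λ { zero → refl ; (suc j) → sym (slice-periodic i j) }) φ
                              (proj₂ (∃-slices (i % period)))

    preserves-all : Surjective 𝔄 h →
                    ∀ {n} (φ : PosHorn σ (suc n)) → Preserves 𝔄 h φ → Preserves 𝔄 h (all φ)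
    preserves-all surjective φ preserves-φ as ∀-slices a with surjective a
    ... | c , refl =
      Sat-cong (∷-extend (hom h) c as) φ (preserves-φ (c ∷ᶠ as) φ-slices)
      where
        φ-slices : ∀ i → Sat 𝔄 (slice (c ∷ᶠ as) i) φ
        φ-slices i = Sat-cong (sym ∘ ∷-extend (λ x → proj₁ x i) c as) φ (∀-slices i (proj₁ c i))

proposition5p4 : (σ : Signature) (𝔄 : Structure σ) (h : Periomorphism 𝔄) →
    Surjective 𝔄 h → ∀ {ℓ} (φ : PosHorn σ ℓ) → Preserves 𝔄 h φ
proposition5p4 σ 𝔄 h surjective (atom (rel R ts)) = preserves-rel 𝔄 h R ts
proposition5p4 σ 𝔄 h surjective (atom (eq s t))   = preserves-eq 𝔄 h s t
proposition5p4 σ 𝔄 h surjective (atom bot)        = λ as ⊥-slices → ⊥-slices 0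
proposition5p4 σ 𝔄 h surjective (φ ∧ ψ)           = λ as φ∧ψ-slices →
  proposition5p4 σ 𝔄 h surjective φ as (proj₁ ∘ φ∧ψ-slices) ,
  proposition5p4 σ 𝔄 h surjective ψ as (proj₂ ∘ φ∧ψ-slices)
proposition5p4 σ 𝔄 h surjective (ex φ)  =
  preserves-ex 𝔄 h φ (proposition5p4 σ 𝔄 h surjective φ)
proposition5p4 σ 𝔄 h surjective (all φ) =
  preserves-all 𝔄 h surjective φ (proposition5p4 σ 𝔄 h surjective φ)
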